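{- Let $G_1,G_2$ be graphs and $k\ge1$ an integer. If $G_1$ is $k$-connected and $G_2$ is not, then $\mathfrak{s}^k_{G_1}\neq\mathfrak{s}^k_{G_2}$.
   Context: Graphs are finite undirected graphs without multiple edges (loops permitted), each on node set $\{1,\dots,n\}$ with $n\ge2$. $k$-connected has its standard meaning (more than $k$ nodes, and the graph stays connected after deleting any fewer than $k$ nodes). $N_G(i)$ is the set of neighbours of $i$; $\{\dots\}^\#$ denotes a multiset. For pairwise distinct nodes $i_1,\dots,i_k$ of $G=(V,E)$ define labels $L_l(i)$, $i\in V$, $l\ge0$: $L_0(i)=(\emptyset,\{c(i)\})$ where $c(i)=q$ if $i=i_q$ and $c(i)=0$ otherwise; for $l\ge1$, $L_l(i)=(L_{l-1}(i),\{L_{l-1}(i'):i'\in N_G(i)\}^\#)$; labels are compared by structural equality, also across graphs. $M^k_G(i_1,\dots,i_k)$ is the matrix with rows indexed by $V$, columns by $l\ge0$, with $(i,l)$ entry $L_l(i)$, and $\mathfrak{s}^k_G(i_1,\dots,i_k)$ is this matrix up to row permutation (the multiset of its rows). For $q=k-1,\dots,0$, $\mathfrak{s}^k_G(i_1,\dots,i_q)=\{\mathfrak{s}^k_G(i_1,\dots,i_q,i'):i'\in V\setminus\{i_1,\dots,i_q\}\}^\#$; the case $q=0$ is the fingerprint $\mathfrak{s}^k_G$. -}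

module Defs where

open import Data.Nat using (ℕ; zero; suc; _≤_; _<_)
open import Data.Fin using (Fin; _≟_)
open import Data.Fin.Subset using (Subset; _∈_; _∉_; ∣_∣)
open import Data.Bool using (Bool; true; false; T; not; if_then_else_)
open import Data.List using (List; []; _∷_; _++_; [_]; map; length; lookup; filterᵇ; allFin)
open import Data.Product using (Σ; _×_)
open import Function.Bundles using (_↔_; Inverse)
open import Relation.Nullary using (¬_; does)
open import Relation.Binary.PropositionalEquality using (_≡_)

-- Graphs on node set {1,…,n}, represented as Fin n; n ≥ 2.
-- Undirected, no multiple edges, loops permitted: a symmetric Bool-valued
-- adjacency relation (adj i i may be true).

record Graph : Set where
  field
    n    : ℕ
    2≤n  : 2 ≤ n
    adj  : Fin n → Fin n → Bool
    sym  : ∀ i j → adj i j ≡ adj j i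
open Graph public

nbrs : (G : Graph) → Fin (n G) → List (Fin (n G))
nbrs G i = filterᵇ (adj G i) (allFin (n G))

MSetEq : {A B : Set} → (A → B → Set) → List A → List B → Set
MSetEq R xs ys =
  Σ (Fin (length xs) ↔ Fin (length ys))
    (λ π → ∀ p → R (lookup xs p) (lookup ys (Inverse.to π p)))

-- Labels.  L_0(i) = (∅,{c(i)}) is encoded as  base c(i);
-- L_l(i) = (L_{l-1}(i), {…}^#) is encoded as  step L_{l-1}(i) (list of
-- neighbour labels); the list is read as a multiset via _≈L_.

data Label : Set where
  base : ℕ → Label
  step : Label → List Label → Label

data _≈L_ : Label → Label → Set where
  base≈ : ∀ {c} → base c ≈L base c
  step≈ : ∀ {a b xs ys} → a ≈L b → MSetEq _≈L_ xs ys → step a xs ≈L step b ys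

-- Colours c(i): q if i = i_q (1-based position in the tuple), 0 otherwise.

colourFrom : ∀ {m} → ℕ → List (Fin m) → Fin m → ℕ
colourFrom q []      i = 0
colourFrom q (x ∷ t) i = if does (i ≟ x) then q else colourFrom (suc q) t i

colour : ∀ {m} → List (Fin m) → Fin m → ℕ
colour = colourFrom 1

L : (G : Graph) → List (Fin (n G)) → ℕ → Fin (n G) → Label
L G t zero    i = base (colour t i)
L G t (suc l) i = step (L G t l i) (map (L G t l) (nbrs G i))

inTuple : ∀ {m} → List (Fin m) → Fin m → Bool
inTuple []      i = false
inTuple (x ∷ t) i = if does (i ≟ x) then true else inTuple t i

rest : ∀ {m} → List (Fin m) → List (Fin m)
rest {m} t = filterᵇ (λ i → not (inTuple t i)) (allFin m)

RowEq : (G₁ G₂ : Graph) → List (Fin (n G₁)) → List (Fin (n G₂)) →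
        Fin (n G₁) → Fin (n G₂) → Set
RowEq G₁ G₂ t₁ t₂ i₁ i₂ = ∀ l → L G₁ t₁ l i₁ ≈L L G₂ t₂ l i₂

-- SEq G₁ G₂ r t₁ t₂  :⇔  s^k_{G₁}(t₁) = s^k_{G₂}(t₂)  where the tuples
-- have length q = k - r.
--   r = 0 : s^k_G(i_1..i_k) = multiset of rows of M^k_G(i_1..i_k)
--   r > 0 : s^k_G(i_1..i_q) = {s^k_G(i_1..i_q,i') : i' ∉ {i_1..i_q}}^#
SEq : (G₁ G₂ : Graph) → ℕ → List (Fin (n G₁)) → List (Fin (n G₂)) → Set
SEq G₁ G₂ zero    t₁ t₂ = MSetEq (RowEq G₁ G₂ t₁ t₂) (allFin (n G₁)) (allFin (n G₂))
SEq G₁ G₂ (suc r) t₁ t₂ =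
  MSetEq (λ x y → SEq G₁ G₂ r (t₁ ++ [ x ]) (t₂ ++ [ y ])) (rest t₁) (rest t₂)

SameFingerprint : ℕ → Graph → Graph → Set
SameFingerprint k G₁ G₂ = SEq G₁ G₂ k [] []

data Reach (G : Graph) (S : Subset (n G)) : Fin (n G) → Fin (n G) → Set where
  here : ∀ {u} → Reach G S u u
  edge : ∀ {u w v} → T (adj G u w) → w ∉ S → Reach G S w v → Reach G S u v

ConnectedWithout : (G : Graph) → Subset (n G) → Set
ConnectedWithout G S = ∀ u v → u ∉ S → v ∉ S → Reach G S u v

KConnected : ℕ → Graph → Set
KConnected k G = k < n G × (∀ (S : Subset (n G)) → ∣ S ∣ < k → ConnectedWithout G S)

-- If the fingerprints agree, G₂ inherits k-connectivity from G₁.  Let S be a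
-- set of m < k nodes of G₂ and u, v ∉ S.  Individualise the nodes of S with
-- colours 1,…,m and v with colour m+1, and pad to k distinct nodes.  Descending
-- the equal fingerprints along this tuple gives a k-tuple in G₁ with the same
-- rows of labels.  In G₁ the nodes coloured 1,…,m are fewer than k, so G₁ minus
-- them contains a walk from the partner of u to the node coloured m+1.  Since
-- L_l(i) unfolds the walks of length l from i, such a walk shows up in the label
-- as a branch avoiding colours 1,…,m and ending at colour m+1; label equality
-- preserves that branch, and in G₂ it folds back to a walk from u to v
-- avoiding S.

module Submission where

open import Defs hiding (sym)
open import Data.Bool using (true; false; not; T)
open import Data.Empty using (⊥-elim)
open import Data.Fin using (Fin; zero; suc; _≟_)
open import Data.Fin.Permutation using (↔⇒≡)
open import Data.Fin.Properties using (injective⇒≤; ¬∀⟶∃¬; suc-injective)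
open import Data.Fin.Subset using (Subset; ∣_∣; ⁅_⁆; _∪_; ⊥; inside; outside)
  renaming (_∈_ to _∈ₛ_; _∉_ to _∉ₛ_)
open import Data.Fin.Subset.Properties
  using (x∈p∪q⁺; x∈p∪q⁻; x∈⁅x⁆; x∈⁅y⁆⇒x≡y; ∉⊥)
open import Data.List using (List; []; _∷_; _++_; [_]; map; length; lookup; allFin; take)
open import Data.List.Properties
  using (++-assoc; ++-identityʳ; filter-all; length-++; length-take; length-map; length-tabulate)
open import Data.List.Membership.Propositional using (_∈_; _∉_; lose; find)
open import Data.List.Membership.Propositional.Properties
  using (∈-filter⁺; ∈-filter⁻; ∈-map⁺; ∈-map⁻; ∈-lookup; ∈-allFin; ∈-++⁺ʳ; ∈-++⁻)
import Data.List.Membership.DecPropositional as DecMembership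
import Data.List.Membership.Setoid.Properties as SetoidMembership
open import Data.List.Relation.Binary.Subset.Propositional using (_⊆_)
import Data.List.Relation.Unary.All as All
open import Data.List.Relation.Unary.AllPairs using ([]; _∷_)
open import Data.List.Relation.Unary.Any as Any using (Any; here; there)
open import Data.List.Relation.Unary.Any.Properties as AnyP using (lookup-index)
open import Data.List.Relation.Unary.Unique.Propositional using (Unique)
open import Data.List.Relation.Unary.Unique.Propositional.Properties as Unique using (allFin⁺)
open import Data.Nat using (ℕ; zero; suc; _≤_; _<_; _≥_; _+_; _∸_; z≤n; s≤s; z<s)
open import Data.Nat.Properties
  using (≤-refl; ≤-reflexive; ≤-trans; ≤-pred; <⇒≤; <⇒≱; 1+n≰n; n≤1+n; m≤m+n; m<m+n; m⊓n≤m;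
         m≤n⇒m<n∨m≡n; m+[n∸m]≡n; +-suc; +-assoc; +-identityʳ)
  renaming (suc-injective to suc-injectiveℕ)
open import Data.Product using (∃-syntax; _×_; _,_; proj₁; proj₂; map₂)
open import Data.Sum as Sum using (_⊎_; inj₁; inj₂)
open import Data.Unit using (tt)
import Data.Vec as Vec
open import Function using (_∘_)
open import Function.Bundles using (_⇔_; mk⇔; Equivalence; Inverse)
open import Relation.Nullary using (¬_; yes; no)
open import Relation.Nullary.Decidable using (T?)
open import Relation.Binary.PropositionalEquality
  using (_≡_; _≢_; refl; sym; trans; cong; subst; setoid)

Unique-lookup-injective : ∀ {A : Set} {xs : List A} → Unique xs →
                          ∀ {p q} → lookup xs p ≡ lookup xs q → p ≡ q
Unique-lookup-injective (_ ∷ _) {zero} {zero} _ = refl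
Unique-lookup-injective (x≢ ∷ _) {zero} {suc q} e = ⊥-elim (All.lookup x≢ (∈-lookup q) e)
Unique-lookup-injective (x≢ ∷ _) {suc p} {zero} e = ⊥-elim (All.lookup x≢ (∈-lookup p) (sym e))
Unique-lookup-injective (_ ∷ u) {suc p} {suc q} e = cong suc (Unique-lookup-injective u e)

Unique⇒length≤ : ∀ {A : Set} {xs ys : List A} → Unique xs → xs ⊆ ys → length xs ≤ length ys
Unique⇒length≤ {xs = xs} {ys} u xs⊆ys = injective⇒≤ position-injective
  where
  position : Fin (length xs) → Fin (length ys)
  position p = Any.index (xs⊆ys (∈-lookup p))
  position-injective : ∀ {p q} → position p ≡ position q → p ≡ q
  position-injective e = Unique-lookup-injective u
    (SetoidMembership.index-injective (setoid _) (xs⊆ys (∈-lookup _)) (xs⊆ys (∈-lookup _)) e)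

length-allFin : ∀ N → length (allFin N) ≡ N
length-allFin N = length-tabulate {n = N} (λ i → i)

∃∉ : ∀ {N} (t : List (Fin N)) → length t < N → ∃[ i ] i ∉ t
∃∉ {N} t t<N = ¬∀⟶∃¬ N (_∈ t) (λ i → DecMembership._∈?_ (_≟_ {N}) i t) λ all∈t →
  <⇒≱ t<N (≤-trans (≤-reflexive (sym (length-allFin N)))
    (Unique⇒length≤ (allFin⁺ N) (λ {i} _ → all∈t i)))

Unique-∷ʳ : ∀ {A : Set} {t : List A} {x} → Unique t → x ∉ t → Unique (t ++ [ x ])
Unique-∷ʳ u x∉t = Unique.++⁺ u (All.[] ∷ []) λ { (x∈t , here refl) → x∉t x∈t }

Unique-++-∷⇒∉ : ∀ {A : Set} (t : List A) {x xs} → Unique (t ++ x ∷ xs) → x ∉ t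
Unique-++-∷⇒∉ (y ∷ t) (y≢ ∷ _) (here refl) = All.lookup y≢ (∈-++⁺ʳ t (here refl)) refl
Unique-++-∷⇒∉ (y ∷ t) (_ ∷ u)  (there x∈t) = Unique-++-∷⇒∉ t u x∈t

length-∷ʳ-+ : ∀ {A : Set} (t : List A) x r → length (t ++ [ x ]) + r ≡ length t + suc r
length-∷ʳ-+ t x r = trans (cong (_+ r) (length-++ t)) (+-assoc (length t) 1 r)

Unique-extend : ∀ {N} {t : List (Fin N)} → Unique t → ∀ r → length t + r ≤ N →
                ∃[ pad ] length pad ≡ r × Unique (t ++ pad)
Unique-extend {t = t} u zero _ = [] , refl , subst Unique (sym (++-identityʳ t)) u
Unique-extend {N} {t} u (suc r) t+r<N
  with x , x∉t ← ∃∉ t (≤-trans (s≤s (m≤m+n (length t) r))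
                                (subst (_≤ N) (+-suc (length t) r) t+r<N))
  with pad , refl , u′ ← Unique-extend (Unique-∷ʳ u x∉t) r
                            (subst (_≤ N) (sym (length-∷ʳ-+ t x r)) t+r<N)
  = x ∷ pad , refl , subst Unique (++-assoc t [ x ] pad) u′

-- Subsets as lists

elements : ∀ {N} → Subset N → List (Fin N)
elements Vec.[]            = []
elements (inside Vec.∷ p)  = zero ∷ map suc (elements p)
elements (outside Vec.∷ p) = map suc (elements p)

length-elements : ∀ {N} (p : Subset N) → length (elements p) ≡ ∣ p ∣
length-elements Vec.[]            = refl
length-elements (inside Vec.∷ p)  = cong suc (trans (length-map suc (elements p)) (length-elements p))
length-elements (outside Vec.∷ p) = trans (length-map suc (elements p)) (length-elements p)

∈-elements⁺ : ∀ {N} {p : Subset N} {i} → i ∈ₛ p → i ∈ elements p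
∈-elements⁺ {p = inside Vec.∷ p}  Vec.here       = here refl
∈-elements⁺ {p = inside Vec.∷ p}  (Vec.there i∈p) = there (∈-map⁺ suc (∈-elements⁺ i∈p))
∈-elements⁺ {p = outside Vec.∷ p} (Vec.there i∈p) = ∈-map⁺ suc (∈-elements⁺ i∈p)

∈-elements⁻ : ∀ {N} (p : Subset N) {i} → i ∈ elements p → i ∈ₛ p
∈-elements⁻ (inside Vec.∷ p) (here refl) = Vec.here
∈-elements⁻ (inside Vec.∷ p) (there i∈)
  with _ , j∈ , refl ← ∈-map⁻ suc i∈ = Vec.there (∈-elements⁻ p j∈)
∈-elements⁻ (outside Vec.∷ p) i∈
  with _ , j∈ , refl ← ∈-map⁻ suc i∈ = Vec.there (∈-elements⁻ p j∈)

elements-Unique : ∀ {N} (p : Subset N) → Unique (elements p)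
elements-Unique Vec.[]            = []
elements-Unique (inside Vec.∷ p)  =
  All.tabulate zero∉suc ∷ Unique.map⁺ suc-injective (elements-Unique p)
  where
  zero∉suc : ∀ {i} → i ∈ map suc (elements p) → zero ≢ i
  zero∉suc i∈ with _ , _ , refl ← ∈-map⁻ suc i∈ = λ ()
elements-Unique (outside Vec.∷ p) = Unique.map⁺ suc-injective (elements-Unique p)

fromList : ∀ {N} → List (Fin N) → Subset N
fromList []      = ⊥
fromList (x ∷ t) = ⁅ x ⁆ ∪ fromList t

∈-fromList⁺ : ∀ {N} {t : List (Fin N)} {i} → i ∈ t → i ∈ₛ fromList t
∈-fromList⁺ (here refl) = x∈p∪q⁺ (inj₁ (x∈⁅x⁆ _))
∈-fromList⁺ (there i∈t) = x∈p∪q⁺ (inj₂ (∈-fromList⁺ i∈t))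

∈-fromList⁻ : ∀ {N} (t : List (Fin N)) {i} → i ∈ₛ fromList t → i ∈ t
∈-fromList⁻ []      i∈ = ⊥-elim (∉⊥ i∈)
∈-fromList⁻ (x ∷ t) i∈ with x∈p∪q⁻ ⁅ x ⁆ (fromList t) i∈
... | inj₁ i∈⁅x⁆ = here (x∈⁅y⁆⇒x≡y x i∈⁅x⁆)
... | inj₂ i∈t   = there (∈-fromList⁻ t i∈t)

∣fromList∣≤length : ∀ {N} (t : List (Fin N)) → ∣ fromList t ∣ ≤ length t
∣fromList∣≤length t = subst (_≤ length t) (length-elements (fromList t))
  (Unique⇒length≤ (elements-Unique (fromList t))
                  (λ i∈ → ∈-fromList⁻ t (∈-elements⁻ (fromList t) i∈)))

length-take≤ : ∀ {A : Set} m (xs : List A) → length (take m xs) ≤ m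
length-take≤ m xs = subst (_≤ m) (sym (length-take m xs)) (m⊓n≤m m (length xs))

take-length-++ : ∀ {A : Set} (xs ys : List A) → take (length xs) (xs ++ ys) ≡ xs
take-length-++ []       ys = refl
take-length-++ (x ∷ xs) ys = cong (x ∷_) (take-length-++ xs ys)

take-suc-length-++ : ∀ {A : Set} (xs : List A) y ys →
                     take (suc (length xs)) (xs ++ y ∷ ys) ≡ xs ++ [ y ]
take-suc-length-++ []       y ys = refl
take-suc-length-++ (x ∷ xs) y ys = cong (x ∷_) (take-suc-length-++ xs y ys)

-- Colours of individualised tuples

colourFrom≡0⊎≥ : ∀ {N} s (t : List (Fin N)) i → colourFrom s t i ≡ 0 ⊎ s ≤ colourFrom s t i
colourFrom≡0⊎≥ s []      i = inj₁ refl
colourFrom≡0⊎≥ s (x ∷ t) i with i ≟ x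
... | yes _ = inj₂ ≤-refl
... | no _  = Sum.map₂ (≤-trans (n≤1+n s)) (colourFrom≡0⊎≥ (suc s) t i)

∈-take⇒colourFrom-range : ∀ {N} s m (t : List (Fin N)) {i} → i ∈ take m t →
                          s ≤ colourFrom s t i × colourFrom s t i < s + m
∈-take⇒colourFrom-range s (suc m) (x ∷ t) {i} i∈ with i ≟ x | i∈
... | yes _   | _           = ≤-refl , m<m+n s z<s
... | no i≢x  | here i≡x    = ⊥-elim (i≢x i≡x)
... | no _    | there i∈t   with ∈-take⇒colourFrom-range (suc s) m t i∈t
...   | s<c , c<s+1+m = <⇒≤ s<c , subst (colourFrom (suc s) t i <_) (sym (+-suc s m)) c<s+1+m

colourFrom-range⇒∈-take : ∀ {N} s m (t : List (Fin N)) {i} → 1 ≤ s →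
                          s ≤ colourFrom s t i → colourFrom s t i < s + m → i ∈ take m t
colourFrom-range⇒∈-take s m []  1≤s s≤c _ = ⊥-elim (<⇒≱ 1≤s s≤c)
colourFrom-range⇒∈-take s zero (x ∷ t) {i} _ s≤c c<s+0 =
  ⊥-elim (<⇒≱ (subst (colourFrom s (x ∷ t) i <_) (+-identityʳ s) c<s+0) s≤c)
colourFrom-range⇒∈-take s (suc m) (x ∷ t) {i} 1≤s s≤c c<s+1+m with i ≟ x
... | yes i≡x = here i≡x
... | no _ with colourFrom≡0⊎≥ (suc s) t i
...   | inj₁ c≡0 = ⊥-elim (<⇒≱ 1≤s (subst (s ≤_) c≡0 s≤c))
...   | inj₂ s<c = there (colourFrom-range⇒∈-take (suc s) m t (≤-trans 1≤s (n≤1+n s)) s<c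
                            (subst (colourFrom (suc s) t i <_) (+-suc s m) c<s+1+m))

Deleted : ℕ → ℕ → Set
Deleted m c = 1 ≤ c × c ≤ m

deleted⇔∈-take : ∀ {N} m (t : List (Fin N)) i → Deleted m (colour t i) ⇔ i ∈ take m t
deleted⇔∈-take m t i = mk⇔
  (λ (1≤c , c≤m) → colourFrom-range⇒∈-take 1 m t ≤-refl 1≤c (s≤s c≤m))
  (λ i∈ → map₂ ≤-pred (∈-take⇒colourFrom-range 1 m t i∈))

Marks : ∀ {N} → List (Fin N) → ℕ → Subset N → Set
Marks t m S = ∀ i → Deleted m (colour t i) ⇔ i ∈ₛ S

marked-subset : ∀ {N} m (t : List (Fin N)) → ∃[ B ] ∣ B ∣ ≤ m × Marks t m B
marked-subset m t =
  fromList (take m t) , ≤-trans (∣fromList∣≤length (take m t)) (length-take≤ m t) , marks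
  where
  marks : Marks t m (fromList (take m t))
  marks i = mk⇔ (λ del → ∈-fromList⁺ (Equivalence.to (deleted⇔∈-take m t i) del))
                (λ i∈ → Equivalence.from (deleted⇔∈-take m t i) (∈-fromList⁻ (take m t) i∈))

deleted⇔∈-prefix : ∀ {N} (ps rs : List (Fin N)) i →
                   Deleted (length ps) (colour (ps ++ rs) i) ⇔ i ∈ ps
deleted⇔∈-prefix ps rs i = subst (λ ys → Deleted (length ps) (colour (ps ++ rs) i) ⇔ i ∈ ys)
  (take-length-++ ps rs) (deleted⇔∈-take (length ps) (ps ++ rs) i)

colour≡suc-length⇔≡ : ∀ {N} (ps pad : List (Fin N)) v → v ∉ ps →
                      ∀ i → colour (ps ++ v ∷ pad) i ≡ suc (length ps) ⇔ i ≡ v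
colour≡suc-length⇔≡ ps pad v v∉ps i = mk⇔ to λ { refl → from }
  where
  xs = ps ++ v ∷ pad
  m = length ps
  deleted⇔∈ps∷ʳv : ∀ j → Deleted (suc m) (colour xs j) ⇔ j ∈ ps ++ [ v ]
  deleted⇔∈ps∷ʳv j = subst (λ ys → Deleted (suc m) (colour xs j) ⇔ j ∈ ys)
                       (take-suc-length-++ ps v pad) (deleted⇔∈-take (suc m) xs j)
  to : colour xs i ≡ suc m → i ≡ v
  to c≡1+m with ∈-++⁻ ps (Equivalence.to (deleted⇔∈ps∷ʳv i)
                             (subst (1 ≤_) (sym c≡1+m) (s≤s z≤n) , ≤-reflexive c≡1+m))
  ... | inj₁ i∈ps       = ⊥-elim (1+n≰n (subst (_≤ m) c≡1+m
                            (proj₂ (Equivalence.from (deleted⇔∈-prefix ps (v ∷ pad) i) i∈ps))))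
  ... | inj₂ (here i≡v) = i≡v
  from : colour xs v ≡ suc m
  from with 1≤c , c≤1+m ← Equivalence.from (deleted⇔∈ps∷ʳv v) (∈-++⁺ʳ ps (here refl))
            with m≤n⇒m<n∨m≡n c≤1+m
  ... | inj₁ c≤m   = ⊥-elim (v∉ps (Equivalence.to (deleted⇔∈-prefix ps (v ∷ pad) v)
                                                   (1≤c , ≤-pred c≤m)))
  ... | inj₂ c≡1+m = c≡1+m

record SeparatorTuple {N} (k m : ℕ) (S : Subset N) (v : Fin N) : Set where
  field
    tuple        : List (Fin N)
    length-tuple : length tuple ≡ k
    unique       : Unique tuple
    marks        : Marks tuple m S
    target       : ∀ i → colour tuple i ≡ suc m ⇔ i ≡ v

separatorTuple : ∀ {N k} (S : Subset N) {v} → v ∉ₛ S → length (elements S) < k → k ≤ N →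
                 SeparatorTuple k (length (elements S)) S v
separatorTuple {N} {k} S {v} v∉S m<k k≤N =
  build (Unique-extend (Unique-∷ʳ (elements-Unique S) v∉ps) r bound)
  where
  ps = elements S
  m = length ps
  r = k ∸ suc m
  v∉ps : v ∉ ps
  v∉ps v∈ps = v∉S (∈-elements⁻ S v∈ps)
  m+1+r≡k : m + suc r ≡ k
  m+1+r≡k = trans (+-suc m r) (m+[n∸m]≡n m<k)
  bound : length (ps ++ [ v ]) + r ≤ N
  bound = subst (_≤ N) (sym (trans (length-∷ʳ-+ ps v r) m+1+r≡k)) k≤N
  build : ∃[ pad ] length pad ≡ r × Unique ((ps ++ [ v ]) ++ pad) → SeparatorTuple k m S v
  build (pad , length-pad , unique) = record
    { tuple        = ps ++ v ∷ pad
    ; length-tuple = trans (length-++ ps) (trans (cong (λ l → m + suc l) length-pad) m+1+r≡k)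
    ; unique       = subst Unique (++-assoc ps [ v ] pad) unique
    ; marks        = λ i → let ps⇔ = deleted⇔∈-prefix ps (v ∷ pad) i in
                       mk⇔ (λ del → ∈-elements⁻ S (Equivalence.to ps⇔ del))
                           (λ i∈S → Equivalence.from ps⇔ (∈-elements⁺ i∈S))
    ; target       = colour≡suc-length⇔≡ ps pad v v∉ps
    }

-- Descending equal fingerprints

∉⇒inTuple≡false : ∀ {N} (t : List (Fin N)) {i} → i ∉ t → inTuple t i ≡ false
∉⇒inTuple≡false []      i∉t = refl
∉⇒inTuple≡false (x ∷ t) {i} i∉t with i ≟ x
... | yes i≡x = ⊥-elim (i∉t (here i≡x))
... | no _    = ∉⇒inTuple≡false t (i∉t ∘ there)

∉⇒∈-rest : ∀ {N} (t : List (Fin N)) {i} → i ∉ t → i ∈ rest t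
∉⇒∈-rest t {i} i∉t = ∈-filter⁺ (T? ∘ λ j → not (inTuple t j)) (∈-allFin i)
  (subst (T ∘ not) (sym (∉⇒inTuple≡false t i∉t)) tt)

rest-[] : ∀ N → rest {N} [] ≡ allFin N
rest-[] N = filter-all (T? ∘ λ _ → true) (All.universal (λ _ → tt) (allFin N))

MSetEq-partnerʳ : ∀ {A B : Set} {R : A → B → Set} {xs ys} → MSetEq R xs ys →
                  ∀ {y} → y ∈ ys → ∃[ x ] R x y
MSetEq-partnerʳ {R = R} {xs} {ys} (π , R-π) y∈ys =
  lookup xs (from p) , subst (R _) to-from-p (R-π (from p))
  where
  open Inverse π
  p = Any.index y∈ys
  to-from-p : lookup ys (to (from p)) ≡ _
  to-from-p = trans (cong (lookup ys) (strictlyInverseˡ p)) (sym (lookup-index y∈ys))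

SEq-descend : ∀ (G₁ G₂ : Graph) r {t₁ t₂} → SEq G₁ G₂ r t₁ t₂ →
              ∀ xs → length xs ≡ r → Unique (t₂ ++ xs) → ∃[ t₁′ ] SEq G₁ G₂ 0 t₁′ (t₂ ++ xs)
SEq-descend G₁ G₂ zero {t₁} {t₂} same [] _ _ =
  t₁ , subst (SEq G₁ G₂ 0 t₁) (sym (++-identityʳ t₂)) same
SEq-descend G₁ G₂ (suc r) {t₁} {t₂} same (x ∷ xs) length≡ u
  with x₁ , same′ ← MSetEq-partnerʳ {R = λ y₁ y₂ → SEq G₁ G₂ r (t₁ ++ [ y₁ ]) (t₂ ++ [ y₂ ])}
                                    {xs = rest t₁} same (∉⇒∈-rest t₂ (Unique-++-∷⇒∉ t₂ u))
  with t₁′ , rows ← SEq-descend G₁ G₂ r same′ xs (suc-injectiveℕ length≡)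
                                (subst Unique (sym (++-assoc t₂ [ x ] xs)) u)
  = t₁′ , subst (SEq G₁ G₂ 0 t₁′) (++-assoc t₂ [ x ] xs) rows

rowPartner : ∀ {G₁ G₂ t₁ t₂} → SEq G₁ G₂ 0 t₁ t₂ → ∀ x → ∃[ w ] RowEq G₁ G₂ t₁ t₂ w x
rowPartner {G₁} {G₂} {t₁} {t₂} rows x =
  MSetEq-partnerʳ {R = RowEq G₁ G₂ t₁ t₂} {xs = allFin (n G₁)} rows (∈-allFin x)

SameFingerprint⇒n≡ : ∀ {G₁ G₂} k → SameFingerprint k G₁ G₂ → n G₁ ≡ n G₂
SameFingerprint⇒n≡ {G₁} {G₂} zero (π , _) =
  trans (sym (length-allFin (n G₁))) (trans (↔⇒≡ π) (length-allFin (n G₂)))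
SameFingerprint⇒n≡ {G₁} {G₂} (suc k) (π , _) =
  trans (sym (length-rest-[] (n G₁))) (trans (↔⇒≡ π) (length-rest-[] (n G₂)))
  where
  length-rest-[] : ∀ N → length (rest {N} []) ≡ N
  length-rest-[] N = trans (cong length (rest-[] N)) (length-allFin N)

-- Walks recorded in labels

∈-nbrs⁺ : ∀ G {i j} → T (adj G i j) → j ∈ nbrs G i
∈-nbrs⁺ G {i} {j} i~j = ∈-filter⁺ (T? ∘ adj G i) (∈-allFin j) i~j

∈-nbrs⁻ : ∀ G {i j} → j ∈ nbrs G i → T (adj G i j)
∈-nbrs⁻ G {i} j∈ = proj₂ (∈-filter⁻ (T? ∘ adj G i) {xs = allFin (n G)} j∈)

colourOf : Label → ℕ
colourOf (base c)   = c
colourOf (step a _) = colourOf a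

colourOf-L : ∀ G t l i → colourOf (L G t l i) ≡ colour t i
colourOf-L G t zero    i = refl
colourOf-L G t (suc l) i = colourOf-L G t l i

≈L⇒colourOf≡ : ∀ {x y} → x ≈L y → colourOf x ≡ colourOf y
≈L⇒colourOf≡ base≈        = refl
≈L⇒colourOf≡ (step≈ a≈b _) = ≈L⇒colourOf≡ a≈b

data TargetPath (m : ℕ) : Label → Set where
  arrive : ∀ {x} → colourOf x ≡ suc m → TargetPath m x
  via    : ∀ {a xs} → ¬ Deleted m (colourOf a) → Any (TargetPath m) xs →
           TargetPath m (step a xs)

TargetPath⇒¬Deleted : ∀ {m x} → TargetPath m x → ¬ Deleted m (colourOf x)
TargetPath⇒¬Deleted {m} (arrive c≡1+m) (_ , c≤m) = 1+n≰n (subst (_≤ m) c≡1+m c≤m)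
TargetPath⇒¬Deleted (via ¬del _) = ¬del

TargetPath-resp-≈L : ∀ {m x y} → TargetPath m x → x ≈L y → TargetPath m y
TargetPath-resp-≈L (arrive c≡1+m) x≈y = arrive (trans (sym (≈L⇒colourOf≡ x≈y)) c≡1+m)
TargetPath-resp-≈L {m} (via ¬del path) (step≈ a≈b (π , xs≈ys)) =
  via (¬del ∘ subst (Deleted m) (sym (≈L⇒colourOf≡ a≈b)))
      (lose (∈-lookup (Inverse.to π p)) (TargetPath-resp-≈L (lookup-index path) (xs≈ys p)))
  where
  p = Any.index path

module _ (G : Graph) (t : List (Fin (n G))) (m : ℕ) where

  walk⇒TargetPath : ∀ {B u} → Marks t m B → colour t u ≡ suc m →
                    ∀ {i} → Reach G B i u → i ∉ₛ B → ∃[ l ] TargetPath m (L G t l i)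
  walk⇒TargetPath B-marks c≡1+m here _ = 0 , arrive c≡1+m
  walk⇒TargetPath B-marks c≡1+m {i} (edge {w = w} i~w w∉B walk) i∉B
    with l , path ← walk⇒TargetPath B-marks c≡1+m walk w∉B
    = suc l , via ¬deleted (AnyP.map⁺ (lose (∈-nbrs⁺ G i~w) path))
    where
    ¬deleted : ¬ Deleted m (colourOf (L G t l i))
    ¬deleted del = i∉B (Equivalence.to (B-marks i) (subst (Deleted m) (colourOf-L G t l i) del))

  TargetPath⇒walk : ∀ {S v} → Marks t m S → (∀ i → colour t i ≡ suc m → i ≡ v) →
                    ∀ l {i} → TargetPath m (L G t l i) → Reach G S i v
  TargetPath⇒walk S-marks only-v zero    (arrive c≡1+m) with refl ← only-v _ c≡1+m = here
  TargetPath⇒walk S-marks only-v (suc l) {i} (arrive c≡1+m)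
    with refl ← only-v i (trans (sym (colourOf-L G t l i)) c≡1+m) = here
  TargetPath⇒walk S-marks only-v (suc l) (via _ paths)
    with j , j∈nbrs , path ← find (AnyP.map⁻ paths)
    = edge (∈-nbrs⁻ G j∈nbrs) j∉S (TargetPath⇒walk S-marks only-v l path)
    where
    j∉S : j ∉ₛ _
    j∉S j∈S = TargetPath⇒¬Deleted path
      (subst (Deleted m) (sym (colourOf-L G t l j)) (Equivalence.from (S-marks j) j∈S))

SameFingerprint⇒KConnected : ∀ {G₁ G₂} k → SameFingerprint k G₁ G₂ →
                             KConnected k G₁ → KConnected k G₂
SameFingerprint⇒KConnected {G₁} {G₂} k same (k<n₁ , connected₁) = k<n₂ , connected₂
  where
  k<n₂ : k < n G₂
  k<n₂ = subst (k <_) (SameFingerprint⇒n≡ k same) k<n₁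
  connected₂ : ∀ S → ∣ S ∣ < k → ConnectedWithout G₂ S
  connected₂ S ∣S∣<k u v u∉S v∉S =
    TargetPath⇒walk G₂ xs m marks (λ i → Equivalence.to (target i)) l path₂
    where
    m = length (elements S)
    m<k : m < k
    m<k = subst (_< k) (sym (length-elements S)) ∣S∣<k
    open SeparatorTuple (separatorTuple S v∉S m<k (<⇒≤ k<n₂)) renaming (tuple to xs)
    descended = SEq-descend G₁ G₂ k same xs length-tuple unique
    t₁ = proj₁ descended
    u₁≈v = rowPartner (proj₂ descended) v
    u₁ = proj₁ u₁≈v
    w≈u = rowPartner (proj₂ descended) u
    w = proj₁ w≈u
    marked = marked-subset m t₁
    B = proj₁ marked
    B-marks : Marks t₁ m B
    B-marks = proj₂ (proj₂ marked)
    ∣B∣<k : ∣ B ∣ < k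
    ∣B∣<k = ≤-trans (s≤s (proj₁ (proj₂ marked))) m<k
    colour-u₁ : colour t₁ u₁ ≡ suc m
    colour-u₁ = trans (≈L⇒colourOf≡ (proj₂ u₁≈v 0)) (Equivalence.from (target v) refl)
    u₁∉B : u₁ ∉ₛ B
    u₁∉B u₁∈B = 1+n≰n (subst (_≤ m) colour-u₁ (proj₂ (Equivalence.from (B-marks u₁) u₁∈B)))
    w∉B : w ∉ₛ B
    w∉B w∈B = u∉S (Equivalence.to (marks u)
      (subst (Deleted m) (≈L⇒colourOf≡ (proj₂ w≈u 0)) (Equivalence.from (B-marks w) w∈B)))
    path₁ = walk⇒TargetPath G₁ t₁ m B-marks colour-u₁ (connected₁ B ∣B∣<k w u₁ w∉B u₁∉B) w∉B
    l = proj₁ path₁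
    path₂ = TargetPath-resp-≈L (proj₂ path₁) (proj₂ w≈u l)

corollary3 : (G₁ G₂ : Graph) (k : ℕ) → k ≥ 1 →
    KConnected k G₁ → ¬ KConnected k G₂ → ¬ SameFingerprint k G₁ G₂
corollary3 G₁ G₂ k _ connected₁ ¬connected₂ same =
  ¬connected₂ (SameFingerprint⇒KConnected k same connected₁)
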